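{- Let $\alpha=\alpha_1\cdots\alpha_n$ be a composition and let $\bm\lambda_\alpha=(R_1,\dots,R_n)$ with $R_i=\big(\sum_{j=1}^{n-i+1}\alpha_j\big)/\big(\sum_{j=1}^{n-i}\alpha_j\big)$. Then $\Pi(\bm\lambda_\alpha)\cong P_\alpha$.
   Context: A composition is a finite sequence of positive integers. A row is $R=a/b=\{(1,j):b+1\le j\le a\}$ with integers $a\ge b\ge0$; $l(R)=b$, $|R|$ its number of cells, $R^+=(a+1)/(b+1)$. For rows $R,R'$: $M(R,R')=|R\cap R'|$ if $l(R)\le l(R')$, else $|R\cap R'^+|$. For a horizontal-strip (sequence of rows) $(R_1,\dots,R_n)$, $\Pi$ is the weighted graph on vertices $1,\dots,n$ with vertex weights $|R_i|$ and for $i<j$ an edge of weight $M(R_i,R_j)$ (zero-weight edges omitted). $P_\alpha$ is the weighted path with vertices $v_1,\dots,v_n$, $v_i$ of weight $\alpha_i$, and edges $(v_i,v_{i+1})$ of weight $1$. Isomorphism means a vertex bijection preserving vertex and edge weights. -}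

module Defs where

open import Data.Nat using (ℕ; zero; suc; _+_; _∸_; _≤_; _<_; z≤n; s≤s; _≤?_; _<?_)
open import Data.Nat.Properties using (≤-refl; +-monoʳ-≤; ≤-trans; m≤m+n)
open import Data.Fin using (Fin; toℕ)
open import Data.List using (List; []; _∷_; length; filter; take; lookup; map; upTo)
open import Data.Nat.ListAction using (sum)
open import Data.List.Relation.Unary.All using (All)
open import Relation.Nullary using (Dec; yes; no)
open import Relation.Nullary.Decidable using (_×-dec_)
open import Data.Product using (_×_)
open import Function.Bundles using (_↔_; Inverse)
open import Relation.Binary.PropositionalEquality using (_≡_; _≢_)

Composition : Set
Composition = List ℕ

IsComposition : Composition → Set
IsComposition α = All (λ x → 0 < x) α

-- Rows  R = a/b = {(1,j) : b+1 ≤ j ≤ a},  a ≥ b ≥ 0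

record Row : Set where
  constructor _/_∣_
  field
    top : ℕ
    bot : ℕ
    bot≤top : bot ≤ top
open Row public

l : Row → ℕ
l R = bot R

_∈R?_ : (j : ℕ) → (R : Row) → Dec ((suc (bot R) ≤ j) × (j ≤ top R))
j ∈R? R = (suc (bot R) ≤? j) ×-dec (j ≤? top R)

range : ℕ → ℕ → List ℕ
range s zero = []
range s (suc k) = s ∷ range (suc s) k

cells : Row → List ℕ
cells R = range (suc (bot R)) (top R ∸ bot R)

∣_∣R : Row → ℕ
∣ R ∣R = length (cells R)

∣_∩_∣ : Row → Row → ℕ
∣ R ∩ R' ∣ = length (filter (λ j → j ∈R? R') (cells R))

_⁺ : Row → Row
(a / b ∣ p) ⁺ = suc a / suc b ∣ s≤s p

M : Row → Row → ℕ
M R R' with l R ≤? l R'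
... | yes _ = ∣ R ∩ R' ∣
... | no  _ = ∣ R ∩ (R' ⁺) ∣

-- Vertex weights, and edge weights for unordered pairs of distinct
-- vertices (weight 0 = no edge, i.e. zero-weight edges omitted).
-- The edge-weight function is read only on pairs of distinct vertices.

record WGraph : Set where
  field
    size   : ℕ
    vw     : Fin size → ℕ
    ew     : Fin size → Fin size → ℕ
open WGraph public

record _≅_ (G H : WGraph) : Set where
  field
    bij    : Fin (size G) ↔ Fin (size H)
  σ : Fin (size G) → Fin (size H)
  σ = Inverse.to bij
  field
    vw-pres : ∀ i → vw H (σ i) ≡ vw G i
    ew-pres : ∀ i j → i ≢ j → ew H (σ i) (σ j) ≡ ew G i j

Π : List Row → WGraph
Π Rs = record
  { size = length Rs
  ; vw   = λ i → ∣ lookup Rs i ∣R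
  ; ew   = λ i j → edge i j
  }
  where
  edge : Fin (length Rs) → Fin (length Rs) → ℕ
  edge i j with toℕ i <? toℕ j | toℕ j <? toℕ i
  ... | yes _ | _     = M (lookup Rs i) (lookup Rs j)
  ... | no _  | yes _ = M (lookup Rs j) (lookup Rs i)
  ... | no _  | no _  = 0

P : Composition → WGraph
P α = record
  { size = length α
  ; vw   = lookup α
  ; ew   = λ i j → edge i j
  }
  where
  edge : Fin (length α) → Fin (length α) → ℕ
  edge i j with suc (toℕ i) Data.Nat.≟ toℕ j | suc (toℕ j) Data.Nat.≟ toℕ i
  ... | yes _ | _     = 1
  ... | no _  | yes _ = 1
  ... | no _  | no _  = 0

S : Composition → ℕ → ℕ
S α m = sum (take m α)

S-step : ∀ α m → S α m ≤ S α (suc m)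
S-step [] zero = ≤-refl
S-step [] (suc m) = ≤-refl
S-step (x ∷ α) zero = z≤n
S-step (x ∷ α) (suc m) = +-monoʳ-≤ x (S-step α m)

-- the row R_i, for i = 1, ..., n (here i is 1-based)
rowOf : Composition → ℕ → Row
rowOf α i = S α (suc (length α ∸ i)) / S α (length α ∸ i) ∣ S-step α (length α ∸ i)

λ[_] : Composition → List Row
λ[ α ] = map (λ k → rowOf α (suc k)) (upTo (length α))

-- With partial sums s₀ < s₁ < ⋯ < sₙ of α, the rows of λ_α are the consecutive
-- blocks s_{m+1}/s_m of a line, listed from the right. Along the strip l strictly
-- decreases, so M(R_i, R_j) compares R_i with the shifted row R_j⁺; shifting a block
-- by one cell makes it meet the next block in exactly one cell and miss all later
-- ones. Hence Π(λ_α) is the path with its vertices in reverse order.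
module Submission where

open import Defs
open import Data.Nat using (ℕ; zero; suc; _+_; _∸_; _≤_; _<_; z≤n; s≤s; _≤?_; _<?_; _≟_)
open import Data.Nat.Properties
open import Data.Fin using (Fin; toℕ; opposite; cast)
open import Data.Fin.Properties using (toℕ-cast; cast-involutive; opposite-prop; opposite-involutive; toℕ-injective; toℕ<n)
open import Data.List using (List; []; _∷_; length; filter; lookup; map; upTo)
open import Data.List.Properties using (length-map; length-upTo; lookup-upTo; filter-accept; filter-reject)
open import Data.List.Relation.Unary.All using (_∷_)
open import Data.Product using (_,_; proj₂)
open import Data.Sum using (inj₁; inj₂)
open import Function.Bundles using (_↔_; Inverse; mk↔ₛ′)
open import Relation.Binary.PropositionalEquality
open import Relation.Binary using (tri<; tri≈; tri>)
open import Relation.Nullary using (yes; no)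
open import Relation.Nullary.Negation using (contradiction)

private
  variable
    A B : Set

lookup-map : (f : A → B) (xs : List A) (i : Fin (length (map f xs))) →
             lookup (map f xs) i ≡ f (lookup xs (cast (length-map f xs) i))
lookup-map f (x ∷ xs) Fin.zero    = refl
lookup-map f (x ∷ xs) (Fin.suc i) = lookup-map f xs i

reverse↔ : ∀ {m n} → m ≡ n → Fin m ↔ Fin n
reverse↔ eq = mk↔ₛ′ (λ i → opposite (cast eq i)) (λ j → cast (sym eq) (opposite j))
  (λ j → trans (cong opposite (cast-involutive eq (sym eq) (opposite j))) (opposite-involutive j))
  (λ i → trans (cong (cast (sym eq)) (opposite-involutive (cast eq i))) (cast-involutive (sym eq) eq i))

toℕ-reverse↔ : ∀ {m n} (eq : m ≡ n) (i : Fin m) →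
               toℕ (Inverse.to (reverse↔ eq) i) ≡ n ∸ suc (toℕ i)
toℕ-reverse↔ {n = n} eq i = trans (opposite-prop (cast eq i)) (cong (λ k → n ∸ suc k) (toℕ-cast eq i))

reverse↔-< : ∀ {m n} (eq : m ≡ n) {i j : Fin m} → toℕ i < toℕ j →
             toℕ (Inverse.to (reverse↔ eq) j) < toℕ (Inverse.to (reverse↔ eq) i)
reverse↔-< {n = n} eq {i} {j} i<j = subst₂ _<_ (sym (toℕ-reverse↔ eq j)) (sym (toℕ-reverse↔ eq i))
  (∸-monoʳ-< (s≤s i<j) (subst (toℕ j <_) eq (toℕ<n j)))

length-range : ∀ s k → length (range s k) ≡ k
length-range s zero    = refl
length-range s (suc k) = cong suc (length-range (suc s) k)

∣R∣≡top∸bot : ∀ R → ∣ R ∣R ≡ top R ∸ bot R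
∣R∣≡top∸bot R = length-range (suc (bot R)) (top R ∸ bot R)

count-range-above : ∀ R s k → top R < s → length (filter (_∈R? R) (range s k)) ≡ 0
count-range-above R s zero    _ = refl
count-range-above R s (suc k) top<s
  rewrite filter-reject (_∈R? R) {s} {range (suc s) k} (λ s∈R → <⇒≱ top<s (proj₂ s∈R))
  = count-range-above R (suc s) k (m<n⇒m<1+n top<s)

count-range-top : ∀ R s k → suc (bot R) ≤ s → top R ≡ s →
                  length (filter (_∈R? R) (range s (suc k))) ≡ 1
count-range-top R s k bot<s refl
  rewrite filter-accept (_∈R? R) {s} {range (suc s) k} (bot<s , ≤-refl)
  = cong suc (count-range-above R (suc s) k ≤-refl)

∩-disjoint : ∀ R R' → top R' ≤ bot R → ∣ R ∩ R' ∣ ≡ 0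
∩-disjoint R R' top'≤bot = count-range-above R' (suc (bot R)) (top R ∸ bot R) (s≤s top'≤bot)

∩-singleton : ∀ R R' → bot R < top R → bot R' ≤ bot R → top R' ≡ suc (bot R) → ∣ R ∩ R' ∣ ≡ 1
∩-singleton R R' bot<top bot'≤bot top'≡ with top R ∸ bot R | m<n⇒0<n∸m bot<top
... | suc k | _ = count-range-top R' (suc (bot R)) k (s≤s bot'≤bot) top'≡

M-shifted : ∀ R R' → l R' < l R → M R R' ≡ ∣ R ∩ R' ⁺ ∣
M-shifted R R' l'<l with l R ≤? l R'
... | yes l≤l' = contradiction l≤l' (<⇒≱ l'<l)
... | no  _    = refl

Π-ew-< : ∀ Rs (i j : Fin (length Rs)) → toℕ i < toℕ j →
         ew (Π Rs) i j ≡ M (lookup Rs i) (lookup Rs j)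
Π-ew-< Rs i j i<j with toℕ i <? toℕ j
... | yes _   = refl
... | no  i≮j = contradiction i<j i≮j

Π-ew-comm : ∀ Rs (i j : Fin (length Rs)) → ew (Π Rs) i j ≡ ew (Π Rs) j i
Π-ew-comm Rs i j with toℕ i <? toℕ j | toℕ j <? toℕ i
... | yes i<j | yes j<i = contradiction i<j (<⇒≯ j<i)
... | yes _   | no  _   = refl
... | no  _   | yes _   = refl
... | no  _   | no  _   = refl

P-ew-comm : ∀ α (a b : Fin (length α)) → ew (P α) a b ≡ ew (P α) b a
P-ew-comm α a b with suc (toℕ a) ≟ toℕ b | suc (toℕ b) ≟ toℕ a
... | yes _ | yes _ = refl
... | yes _ | no  _ = refl
... | no  _ | yes _ = refl
... | no  _ | no  _ = refl

P-ew-adjacent : ∀ α (a b : Fin (length α)) → toℕ a ≡ suc (toℕ b) → ew (P α) a b ≡ 1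
P-ew-adjacent α a b a≡1+b with suc (toℕ a) ≟ toℕ b | suc (toℕ b) ≟ toℕ a
... | yes _ | _     = refl
... | no  _ | yes _ = refl
... | no  _ | no  ≢ = contradiction (sym a≡1+b) ≢

P-ew-far : ∀ α (a b : Fin (length α)) → suc (suc (toℕ b)) ≤ toℕ a → ew (P α) a b ≡ 0
P-ew-far α a b 2+b≤a with suc (toℕ a) ≟ toℕ b | suc (toℕ b) ≟ toℕ a
... | yes a<b | _     = contradiction (≤-trans (m≤n+m _ 2) 2+b≤a) (<⇒≱ (≤-reflexive a<b))
... | no  _   | yes ≡ = contradiction (subst (suc (suc (toℕ b)) ≤_) (sym ≡) 2+b≤a) (n≮n _)
... | no  _   | no  _ = refl

S-suc : ∀ α (a : Fin (length α)) → S α (suc (toℕ a)) ≡ S α (toℕ a) + lookup α a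
S-suc (x ∷ α) Fin.zero    = +-identityʳ x
S-suc (x ∷ α) (Fin.suc a) = trans (cong (x +_) (S-suc α a)) (sym (+-assoc x _ _))

S-mono : ∀ α {m m'} → m ≤ m' → S α m ≤ S α m'
S-mono α       z≤n      = z≤n
S-mono []      (s≤s _)  = ≤-refl
S-mono (x ∷ α) (s≤s le) = +-monoʳ-≤ x (S-mono α le)

S-<-suc : ∀ {α} → IsComposition α → ∀ {m} → m < length α → S α m < S α (suc m)
S-<-suc {x ∷ α} (0<x ∷ _) {zero}  _         = <-≤-trans 0<x (m≤m+n x 0)
S-<-suc {x ∷ α} (_ ∷ c)   {suc m} (s≤s m<n) = +-monoʳ-< x (S-<-suc c m<n)

S-< : ∀ {α} → IsComposition α → ∀ {m m'} → m < m' → m' ≤ length α → S α m < S α m'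
S-< {α} c m<m' m'≤n = <-≤-trans (S-<-suc c (<-≤-trans m<m' m'≤n)) (S-mono α m<m')

module Strip (α : Composition) (c : IsComposition α) where

  n : ℕ
  n = length α

  -- The paper's R_i (1-based i) is rowOf α i = block (n ∸ i).
  block : ℕ → Row
  block m = S α (suc m) / S α m ∣ S-step α m

  ∣block∣ : (a : Fin n) → ∣ block (toℕ a) ∣R ≡ lookup α a
  ∣block∣ a = begin
    ∣ block (toℕ a) ∣R                        ≡⟨ ∣R∣≡top∸bot (block (toℕ a)) ⟩
    S α (suc (toℕ a)) ∸ S α (toℕ a)          ≡⟨ cong (_∸ S α (toℕ a)) (S-suc α a) ⟩
    S α (toℕ a) + lookup α a ∸ S α (toℕ a)   ≡⟨ m+n∸m≡n (S α (toℕ a)) (lookup α a) ⟩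
    lookup α a                               ∎
    where open ≡-Reasoning

  M-block-adjacent : ∀ {m} → suc m < n → M (block (suc m)) (block m) ≡ 1
  M-block-adjacent {m} 1+m<n = begin
    M (block (suc m)) (block m)     ≡⟨ M-shifted (block (suc m)) (block m) S-m<S-1+m ⟩
    ∣ block (suc m) ∩ block m ⁺ ∣   ≡⟨ ∩-singleton (block (suc m)) (block m ⁺) (S-<-suc c 1+m<n) S-m<S-1+m refl ⟩
    1                               ∎
    where open ≡-Reasoning
          S-m<S-1+m = S-<-suc c (<-trans (n<1+n m) 1+m<n)

  M-block-far : ∀ {m m'} → suc (suc m') ≤ m → m < n → M (block m) (block m') ≡ 0
  M-block-far {m} {m'} 2+m'≤m m<n = begin
    M (block m) (block m')          ≡⟨ M-shifted (block m) (block m') (S-< c (≤-trans (n≤1+n _) 2+m'≤m) (<⇒≤ m<n)) ⟩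
    ∣ block m ∩ block m' ⁺ ∣        ≡⟨ ∩-disjoint (block m) (block m' ⁺) (S-< c 2+m'≤m (<⇒≤ m<n)) ⟩
    0                               ∎
    where open ≡-Reasoning

  M-block≡P-ew : (a b : Fin n) → toℕ b < toℕ a → M (block (toℕ a)) (block (toℕ b)) ≡ ew (P α) a b
  M-block≡P-ew a b b<a with m≤n⇒m<n∨m≡n b<a
  ... | inj₁ 1+b<a = trans (M-block-far 1+b<a (toℕ<n a)) (sym (P-ew-far α a b 1+b<a))
  ... | inj₂ 1+b≡a = trans (subst (λ k → M (block k) (block (toℕ b)) ≡ 1) 1+b≡a adjacent)
                           (sym (P-ew-adjacent α a b (sym 1+b≡a)))
    where adjacent : M (block (suc (toℕ b))) (block (toℕ b)) ≡ 1
          adjacent = M-block-adjacent (subst (_< n) (sym 1+b≡a) (toℕ<n a))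

  length-λ : length λ[ α ] ≡ n
  length-λ = trans (length-map (λ k → rowOf α (suc k)) (upTo n)) (length-upTo n)

  σ : Fin (length λ[ α ]) → Fin n
  σ = Inverse.to (reverse↔ length-λ)

  lookup-λ : (i : Fin (length λ[ α ])) → lookup λ[ α ] i ≡ block (toℕ (σ i))
  lookup-λ i = begin
    lookup λ[ α ] i                                  ≡⟨ lookup-map (λ k → rowOf α (suc k)) (upTo n) i ⟩
    rowOf α (suc (lookup (upTo n) (cast eq i)))      ≡⟨ cong (λ k → rowOf α (suc k)) (lookup-upTo n (cast eq i)) ⟩
    rowOf α (suc (toℕ (cast eq i)))                  ≡⟨ cong (λ k → rowOf α (suc k)) (toℕ-cast eq i) ⟩
    block (n ∸ suc (toℕ i))                          ≡⟨ cong block (toℕ-reverse↔ length-λ i) ⟨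
    block (toℕ (σ i))                                ∎
    where open ≡-Reasoning
          eq : length λ[ α ] ≡ length (upTo n)
          eq = length-map (λ k → rowOf α (suc k)) (upTo n)

  vw-σ : ∀ i → vw (P α) (σ i) ≡ vw (Π λ[ α ]) i
  vw-σ i = trans (sym (∣block∣ (σ i))) (cong ∣_∣R (sym (lookup-λ i)))

  ew-σ-< : ∀ i j → toℕ i < toℕ j → ew (P α) (σ i) (σ j) ≡ ew (Π λ[ α ]) i j
  ew-σ-< i j i<j = begin
    ew (P α) (σ i) (σ j)                        ≡⟨ M-block≡P-ew (σ i) (σ j) (reverse↔-< length-λ i<j) ⟨
    M (block (toℕ (σ i))) (block (toℕ (σ j)))   ≡⟨ cong₂ M (lookup-λ i) (lookup-λ j) ⟨
    M (lookup λ[ α ] i) (lookup λ[ α ] j)       ≡⟨ Π-ew-< λ[ α ] i j i<j ⟨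
    ew (Π λ[ α ]) i j                           ∎
    where open ≡-Reasoning

  ew-σ : ∀ i j → i ≢ j → ew (P α) (σ i) (σ j) ≡ ew (Π λ[ α ]) i j
  ew-σ i j i≢j with <-cmp (toℕ i) (toℕ j)
  ... | tri< i<j _ _ = ew-σ-< i j i<j
  ... | tri≈ _ i≡j _ = contradiction (toℕ-injective i≡j) i≢j
  ... | tri> _ _ j<i = begin
    ew (P α) (σ i) (σ j)   ≡⟨ P-ew-comm α (σ i) (σ j) ⟩
    ew (P α) (σ j) (σ i)   ≡⟨ ew-σ-< j i j<i ⟩
    ew (Π λ[ α ]) j i      ≡⟨ Π-ew-comm λ[ α ] j i ⟩
    ew (Π λ[ α ]) i j      ∎
    where open ≡-Reasoning

proposition4p9 : (α : Composition) → IsComposition α → Π λ[ α ] ≅ P α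
proposition4p9 α c = record
  { bij     = reverse↔ length-λ
  ; vw-pres = vw-σ
  ; ew-pres = ew-σ
  }
  where open Strip α c
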